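{- There is an algorithm which, given a function $f\colon\mathbb{N}\to\mathbb{N}$ such that $f^{ -1}\{n+1\}$ is finite for every $n\in\mathbb{N}$, computes two functions $g,h\colon\mathbb{N}\to\mathbb{N}$ such that for every $n$, $|g^{ -1}\{n+1\}|+|h^{ -1}\{n+1\}|=|f^{ -1}\{n+1\}|$, and such that there exists an increasing sequence $(S_i)_i$ of natural numbers with $g^{ -1}\{1,\ldots,S_i\}\subseteq\{0,\ldots,S_i-1\}$ for all even $i$ and $h^{ -1}\{1,\ldots,S_i\}\subseteq\{0,\ldots,S_i-1\}$ for all odd $i$.
   Context: For a function $f\colon\mathbb{N}\to\mathbb{N}$ and a set $S\subseteq\mathbb{N}$, $f^{ -1}S:=\{i\in\mathbb{N}: f(i)\in S\}$. -}

module Defs where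

open import Data.Nat using (ℕ; zero; suc; _+_; _*_; _≤_; _<_)
open import Data.Nat.Properties using (_≟_)
open import Data.Product using (Σ; _×_)
open import Relation.Binary.PropositionalEquality using (_≡_)
open import Relation.Nullary using (yes; no)

FinitePreimage : (ℕ → ℕ) → ℕ → Set
FinitePreimage f n = Σ ℕ λ B → ∀ i → f i ≡ suc n → i < B

countBelow : (ℕ → ℕ) → ℕ → ℕ → ℕ
countBelow f v zero = zero
countBelow f v (suc B) with f B ≟ v
... | yes _ = suc (countBelow f v B)
... | no _  = countBelow f v B

-- |g⁻¹{n+1}| + |h⁻¹{n+1}| = |f⁻¹{n+1}| : all three preimages lie below a
-- common bound B, and the counts below B satisfy the equation.
CardSplit : (f g h : ℕ → ℕ) → ℕ → Set
CardSplit f g h n = Σ ℕ λ B →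
  (∀ i → f i ≡ suc n → i < B) ×
  (∀ i → g i ≡ suc n → i < B) ×
  (∀ i → h i ≡ suc n → i < B) ×
  (countBelow g (suc n) B + countBelow h (suc n) B ≡ countBelow f (suc n) B)

PreimageBelow : (ℕ → ℕ) → ℕ → Set
PreimageBelow g s = ∀ j → 1 ≤ g j → g j ≤ s → j < s

StrictlyIncreasing : (ℕ → ℕ) → Set
StrictlyIncreasing S = ∀ i → S i < S (suc i)

GoodSplit : (f g h : ℕ → ℕ) → Set
GoodSplit f g h =
  (∀ n → CardSplit f g h n) ×
  (Σ (ℕ → ℕ) λ S → StrictlyIncreasing S ×
     (∀ m → PreimageBelow g (S (2 * m))) ×
     (∀ m → PreimageBelow h (S (suc (2 * m)))))

{-# OPTIONS --safe #-}
-- Choose scales S₀ = 0 < S₁ < … with S_{k+1} above every j for which f j ∈ {1,…,S_k}, let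
-- the block of j be the least k with f j ≤ S_k, and give the points of odd blocks to g and
-- those of even blocks to h. A point j ≥ S_k with f j ∈ {1,…,S_k} lies in block k, so
-- {1,…,S_k} has no preimage beyond S_k under g for even k and under h for odd k. Finding the
-- S_k needs the bounds on the finite preimages, but the block of j does not: it only involves
-- scales S_k ≤ j, and those are already determined by f 0, …, f j.
module Submission where

open import Defs
open import Algebra.Properties.CommutativeSemigroup using (interchange)
open import Data.Nat.Base
  using (ℕ; zero; suc; _+_; _*_; _≤_; _<_; _⊔_; _⊓_; z≤n; s≤s; z<s; parity)
open import Data.Nat.Properties
  using (_≟_; _≤?_; _<?_; ≤-refl; ≤-trans; <-trans; <-≤-trans; <⇒≤; <⇒≱; ≤⇒≯; ≮⇒≥; ≤-pred;
         m≤n⇒m<n∨m≡n; m<1+n⇒m<n∨m≡n; m≤m⊔n; m≤n⊔m; m⊓n≤m; m⊓n≤n; ⊓-glb;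
         +-identityʳ; +-commutativeSemigroup)
open import Data.Parity.Base as ℙ using (Parity; 0ℙ; 1ℙ; _⁻¹)
open import Data.Parity.Properties using (+-homo-+; *-homo-*; p≢p⁻¹)
open import Data.Product using (Σ; _×_; _,_; proj₁; proj₂)
open import Data.Sum using (inj₁; inj₂)
open import Level using (Level)
open import Relation.Binary.PropositionalEquality
  using (_≡_; refl; sym; trans; cong; cong₂; subst; module ≡-Reasoning)
open import Relation.Nullary using (yes; no; ¬_; contradiction)
open import Relation.Nullary.Decidable using (_×-dec_)
open import Relation.Unary using (Pred; Decidable)

private
  variable
    ℓ : Level

module _ {P : Pred ℕ ℓ} (P? : Decidable P) where

  lastBelow : ℕ → ℕ
  lastBelow zero = zero
  lastBelow (suc t) with P? t
  ... | yes _ = suc t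
  ... | no  _ = lastBelow t

  <-lastBelow : ∀ {j t} → j < t → P j → j < lastBelow t
  <-lastBelow {j} {suc t} j<1+t pj with P? t
  ... | yes _ = j<1+t
  ... | no ¬pt with m<1+n⇒m<n∨m≡n j<1+t
  ...   | inj₁ j<t  = <-lastBelow j<t pj
  ...   | inj₂ refl = contradiction pj ¬pt

  lastBelow-beyondAll : ∀ {u t} → u ≤ t → (∀ {j} → P j → j < u) → lastBelow t ≡ lastBelow u
  lastBelow-beyondAll {u} {zero}  z≤n  below = refl
  lastBelow-beyondAll {u} {suc t} u≤1+t below with m≤n⇒m<n∨m≡n u≤1+t
  ... | inj₂ refl = refl
  ... | inj₁ u<1+t with P? t
  ...   | yes pt = contradiction (below pt) (≤⇒≯ (≤-pred u<1+t))
  ...   | no  _  = lastBelow-beyondAll (≤-pred u<1+t) below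

  lastBelow-irrelevant : ∀ {u t} → (∀ {j} → P j → j < u) → (∀ {j} → P j → j < t) →
                         lastBelow t ≡ lastBelow u
  lastBelow-irrelevant {u} {t} belowU belowT = trans
    (lastBelow-beyondAll (m⊓n≤n u t) below)
    (sym (lastBelow-beyondAll (m⊓n≤m u t) below))
    where
    below : ∀ {j} → P j → j < u ⊓ t
    below pj = ⊓-glb (belowU pj) (belowT pj)

-- the least r ≤ n satisfying P, or n if there is none
firstUpTo : {P : Pred ℕ ℓ} → Decidable P → ℕ → ℕ
firstUpTo P? zero = zero
firstUpTo P? (suc n) with P? 0
... | yes _ = zero
... | no  _ = suc (firstUpTo (λ r → P? (suc r)) n)

firstUpTo-unique : {P : Pred ℕ ℓ} (P? : Decidable P) → ∀ {r n} → r ≤ n → P r →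
                   (∀ {b} → b < r → ¬ P b) → firstUpTo P? n ≡ r
firstUpTo-unique P? {zero} {zero} _ _ _ = refl
firstUpTo-unique P? {zero} {suc n} _ p0 _ with P? 0
... | yes _  = refl
... | no ¬p0 = contradiction p0 ¬p0
firstUpTo-unique P? {suc r} {suc n} r≤n pr before with P? 0
... | yes p0 = contradiction p0 (before z<s)
... | no  _  =
  cong suc (firstUpTo-unique (λ b → P? (suc b)) (≤-pred r≤n) pr (λ b<r → before (s≤s b<r)))

StrictlyIncreasing⇒monotone : ∀ {S} → StrictlyIncreasing S → ∀ {a b} → a ≤ b → S a ≤ S b
StrictlyIncreasing⇒monotone {S} inc {a} {b} a≤b with m≤n⇒m<n∨m≡n a≤b
... | inj₂ refl = ≤-refl
StrictlyIncreasing⇒monotone {S} inc {a} {suc b} _ | inj₁ a<1+b =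
  ≤-trans (StrictlyIncreasing⇒monotone inc (≤-pred a<1+b)) (<⇒≤ (inc b))

StrictlyIncreasing⇒n≤S[n] : ∀ {S} → StrictlyIncreasing S → ∀ n → n ≤ S n
StrictlyIncreasing⇒n≤S[n] inc zero    = z≤n
StrictlyIncreasing⇒n≤S[n] inc (suc n) = <-≤-trans (s≤s (StrictlyIncreasing⇒n≤S[n] inc n)) (inc n)

parity-even : ∀ m → parity (2 * m) ≡ 0ℙ
parity-even m = *-homo-* 2 m

parity-odd : ∀ m → parity (suc (2 * m)) ≡ 1ℙ
parity-odd m = trans (+-homo-+ 1 (2 * m)) (cong (1ℙ ℙ.+_) (parity-even m))

keepIf : Parity → Parity → ℕ → ℕ
keepIf 0ℙ 0ℙ x = x
keepIf 1ℙ 1ℙ x = x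
keepIf 0ℙ 1ℙ x = 0
keepIf 1ℙ 0ℙ x = 0

keepIf-nonzero : ∀ p q x → 1 ≤ keepIf p q x → keepIf p q x ≡ x × p ≡ q
keepIf-nonzero 0ℙ 0ℙ x _ = refl , refl
keepIf-nonzero 1ℙ 1ℙ x _ = refl , refl

indicator : ℕ → ℕ → ℕ
indicator x v with x ≟ v
... | yes _ = 1
... | no  _ = 0

countBelow-suc : ∀ g v B → countBelow g v (suc B) ≡ indicator (g B) v + countBelow g v B
countBelow-suc g v B with g B ≟ v
... | yes _ = refl
... | no  _ = refl

indicator-keepIf : ∀ q x v →
  indicator (keepIf 1ℙ q x) (suc v) + indicator (keepIf 0ℙ q x) (suc v) ≡ indicator x (suc v)
indicator-keepIf 0ℙ x v = refl
indicator-keepIf 1ℙ x v = +-identityʳ (indicator x (suc v))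

part : Parity → (ℕ → Parity) → (ℕ → ℕ) → ℕ → ℕ
part p c f j = keepIf p (c j) (f j)

part-preimage : ∀ p c f {j v} → part p c f j ≡ suc v → f j ≡ suc v
part-preimage p c f {j} eq =
  trans (sym (proj₁ (keepIf-nonzero p (c j) (f j) (subst (1 ≤_) (sym eq) (s≤s z≤n))))) eq

countBelow-parts : ∀ c f v B →
  countBelow (part 1ℙ c f) (suc v) B + countBelow (part 0ℙ c f) (suc v) B ≡ countBelow f (suc v) B
countBelow-parts c f v zero    = refl
countBelow-parts c f v (suc B) = begin
  countBelow (part 1ℙ c f) (suc v) (suc B) + countBelow (part 0ℙ c f) (suc v) (suc B)
    ≡⟨ cong₂ _+_ (countBelow-suc (part 1ℙ c f) (suc v) B)
                 (countBelow-suc (part 0ℙ c f) (suc v) B) ⟩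
  (indicator (part 1ℙ c f B) (suc v) + countBelow (part 1ℙ c f) (suc v) B) +
  (indicator (part 0ℙ c f B) (suc v) + countBelow (part 0ℙ c f) (suc v) B)
    ≡⟨ interchange +-commutativeSemigroup
         (indicator (part 1ℙ c f B) (suc v)) (countBelow (part 1ℙ c f) (suc v) B) _ _ ⟩
  (indicator (part 1ℙ c f B) (suc v) + indicator (part 0ℙ c f B) (suc v)) +
  (countBelow (part 1ℙ c f) (suc v) B + countBelow (part 0ℙ c f) (suc v) B)
    ≡⟨ cong₂ _+_ (indicator-keepIf (c B) (f B) v) (countBelow-parts c f v B) ⟩
  indicator (f B) (suc v) + countBelow f (suc v) B
    ≡⟨ countBelow-suc f (suc v) B ⟨
  countBelow f (suc v) (suc B) ∎
  where open ≡-Reasoning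

parts-CardSplit : ∀ c f n → FinitePreimage f n → CardSplit f (part 1ℙ c f) (part 0ℙ c f) n
parts-CardSplit c f n (B , below) =
  B , below , (λ j eq → below j (part-preimage 1ℙ c f eq)) ,
  (λ j eq → below j (part-preimage 0ℙ c f eq)) , countBelow-parts c f n B

part-PreimageBelow : ∀ p c f s → (∀ j → 1 ≤ f j → f j ≤ s → s ≤ j → c j ≡ p) →
                     PreimageBelow (part (p ⁻¹) c f) s
part-PreimageBelow p c f s colour j 1≤part part≤s with j <? s
... | yes j<s = j<s
... | no  j≮s = contradiction (sym (trans (proj₂ kept) cj≡p)) (p≢p⁻¹ p)
  where
  kept : part (p ⁻¹) c f j ≡ f j × p ⁻¹ ≡ c j
  kept = keepIf-nonzero (p ⁻¹) (c j) (f j) 1≤part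
  cj≡p : c j ≡ p
  cj≡p = colour j (subst (1 ≤_) (proj₁ kept) 1≤part) (subst (_≤ s) (proj₁ kept) part≤s)
                  (≮⇒≥ j≮s)

InRange : ℕ → ℕ → Set
InRange s x = 1 ≤ x × x ≤ s

inRange? : ∀ s → Decidable (InRange s)
inRange? s x = 1 ≤? x ×-dec x ≤? s

-- the scale following s, as far as it can be read off f 0, …, f (t - 1)
nextScale : (ℕ → ℕ) → ℕ → ℕ → ℕ
nextScale f t s = suc s ⊔ lastBelow (λ j → inRange? s (f j)) t

scales : (ℕ → ℕ) → ℕ → ℕ → ℕ
scales f t zero    = zero
scales f t (suc k) = nextScale f t (scales f t k)

block : (ℕ → ℕ) → ℕ → ℕ
block f j = firstUpTo (λ k → f j ≤? scales f (suc j) k) j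

colour : (ℕ → ℕ) → ℕ → Parity
colour f j = parity (block f j)

<-nextScale : ∀ f {t s j} → j < t → InRange s (f j) → j < nextScale f t s
<-nextScale f {t} {s} j<t inRange =
  <-≤-trans (<-lastBelow (λ j → inRange? s (f j)) j<t inRange) (m≤n⊔m (suc s) _)

nextScale-irrelevant : ∀ f {t u s} → (∀ {j} → InRange s (f j) → j < u) →
                       (∀ {j} → InRange s (f j) → j < t) → nextScale f t s ≡ nextScale f u s
nextScale-irrelevant f {s = s} belowU belowT =
  cong (suc s ⊔_) (lastBelow-irrelevant (λ j → inRange? s (f j)) belowU belowT)

module Scales (f : ℕ → ℕ) (finite : ∀ n → FinitePreimage f n) where

  bound : ℕ → ℕ
  bound zero    = zero
  bound (suc s) = bound s ⊔ proj₁ (finite s)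

  <-bound : ∀ {s j} → InRange s (f j) → j < bound s
  <-bound {zero}  (1≤fj , fj≤0)   = contradiction fj≤0 (<⇒≱ 1≤fj)
  <-bound {suc s} {j} (1≤fj , fj≤1+s) with m≤n⇒m<n∨m≡n fj≤1+s
  ... | inj₁ fj<1+s = <-≤-trans (<-bound (1≤fj , ≤-pred fj<1+s)) (m≤m⊔n (bound s) _)
  ... | inj₂ fj≡1+s = <-≤-trans (proj₂ (finite s) j fj≡1+s) (m≤n⊔m (bound s) _)

  S : ℕ → ℕ
  S zero    = zero
  S (suc k) = nextScale f (bound (S k)) (S k)

  S-increasing : StrictlyIncreasing S
  S-increasing k = m≤m⊔n (suc (S k)) (lastBelow (λ j → inRange? (S k) (f j)) (bound (S k)))

  <-S-suc : ∀ k {j} → InRange (S k) (f j) → j < S (suc k)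
  <-S-suc k inRange = <-nextScale f (<-bound inRange) inRange

  scales-exact : ∀ {t} k → S k < t → scales f t k ≡ S k
  scales-exact zero    _         = refl
  scales-exact {t} (suc k) S[1+k]<t = begin
    nextScale f t (scales f t k)
      ≡⟨ cong (nextScale f t) (scales-exact k (<-trans (S-increasing k) S[1+k]<t)) ⟩
    nextScale f t (S k)
      ≡⟨ nextScale-irrelevant f <-bound (λ inRange → <-trans (<-S-suc k inRange) S[1+k]<t) ⟩
    nextScale f (bound (S k)) (S k) ∎
    where open ≡-Reasoning

  -- an earlier block b < k would put j below S (suc b) ≤ S k ≤ j
  block-exact : ∀ {k j} → InRange (S k) (f j) → S k ≤ j → block f j ≡ k
  block-exact {k} {j} (1≤fj , fj≤Sk) Sk≤j =
    firstUpTo-unique (λ b → f j ≤? scales f (suc j) b)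
      (≤-trans (StrictlyIncreasing⇒n≤S[n] S-increasing k) Sk≤j)
      (subst (f j ≤_) (sym (scales-exact k (s≤s Sk≤j))) fj≤Sk)
      notEarlier
    where
    notEarlier : ∀ {b} → b < k → ¬ f j ≤ scales f (suc j) b
    notEarlier {b} b<k fj≤ = <⇒≱ (<-≤-trans (<-S-suc b (1≤fj , fj≤Sb)) S[1+b]≤Sk) Sk≤j
      where
      S[1+b]≤Sk : S (suc b) ≤ S k
      S[1+b]≤Sk = StrictlyIncreasing⇒monotone S-increasing b<k
      fj≤Sb : f j ≤ S b
      fj≤Sb = subst (f j ≤_) (scales-exact b (s≤s Sb≤j)) fj≤
        where
        Sb≤j : S b ≤ j
        Sb≤j = ≤-trans (StrictlyIncreasing⇒monotone S-increasing (<⇒≤ b<k)) Sk≤j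

  part-PreimageBelow-S : ∀ k {p} → parity k ≡ p →
                         PreimageBelow (part (p ⁻¹) (colour f) f) (S k)
  part-PreimageBelow-S k parity≡p = part-PreimageBelow _ (colour f) f (S k)
    (λ j 1≤fj fj≤Sk Sk≤j → trans (cong parity (block-exact {k} (1≤fj , fj≤Sk) Sk≤j)) parity≡p)

lemma9p1 : Σ ((ℕ → ℕ) → (ℕ → ℕ) × (ℕ → ℕ)) λ A →
    ∀ (f : ℕ → ℕ) → (∀ n → FinitePreimage f n) →
    GoodSplit f (proj₁ (A f)) (proj₂ (A f))
lemma9p1 = (λ f → part 1ℙ (colour f) f , part 0ℙ (colour f) f) , good
  where
  good : ∀ f → (∀ n → FinitePreimage f n) →
         GoodSplit f (part 1ℙ (colour f) f) (part 0ℙ (colour f) f)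
  good f finite =
    (λ n → parts-CardSplit (colour f) f n (finite n)) ,
    S , S-increasing ,
    (λ m → part-PreimageBelow-S (2 * m) (parity-even m)) ,
    (λ m → part-PreimageBelow-S (suc (2 * m)) (parity-odd m))
    where open Scales f finite
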